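{- Let $L$ be a join-semilattice with finite connected decompositions, let $(A,B)$ be a finite duality in $L$, let $r\in B$, and let $M$ be the set of minimal elements of $\{x\in A_{\mathrm{Cn}}: x\not\le r\}$. Then $M$ is a quasitransversal of $A$, and if $N$ is a transversal of $A$ with $M\sqsubseteq N$, then $r=r(N)$, i.e. $r$ is the unique element $r'\in B$ with $N\cap{\downarrow}r'=\emptyset$ and $\overline N\subseteq{\downarrow}r'$.
   Context: $L$ is a join-semilattice. For $M\subseteq L$: ${\downarrow}M=\{x:\exists m\in M,\ x\le m\}$, ${\uparrow}M=\{x:\exists m\in M,\ x\ge m\}$. An element $a$ is connected if $a\le b\vee c$ implies $a\le b$ or $a\le c$; $\mathrm{Cn}\,L$ is the set of connected elements. $L$ has finite connected decompositions if every $a$ equals $\bigvee F$ for some finite $F\subseteq\mathrm{Cn}\,L$. A connected component of $a$ is a $c\in\mathrm{Cn}\,L$ such that $a=c$ or $a=b\vee c\ne b$ for some $b$; $A_{\mathrm{Cn}}$ is the set of connected components of elements of $A$. A finite duality is a pair $(A,B)$ of finite subsets, each consisting of pairwise incomparable elements, with ${\downarrow}B=L\setminus{\uparrow}A$. For antichains $M,N$: $M\sqsubseteq N$ iff $N\subseteq{\uparrow}M$. A quasitransversal of $A$ is an antichain $M\subseteq A_{\mathrm{Cn}}$ with $A\subseteq{\uparrow}M$; a transversal is a quasitransversal $N$ with no quasitransversal $N'\neq N$ satisfying $N\sqsubseteq N'$. $\overline N=A_{\mathrm{Cn}}\setminus{\uparrow}N$. For a transversal $N$ of $A$ (with $B\neq\emptyset$)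 there is exactly one $r(N)\in B$ with $N\cap{\downarrow}r(N)=\emptyset$ and $\overline N\subseteq{\downarrow}r(N)$. -}

module Defs where

open import Level using (Level; _⊔_)
open import Data.Product using (Σ; ∃; ∃-syntax; _×_; _,_)
open import Data.Sum using (_⊎_)
open import Data.List using (List; []; _∷_)
open import Data.List.Relation.Unary.All using (All)
open import Data.List.Relation.Unary.Any using (Any)
open import Relation.Nullary using (¬_)
open import Relation.Unary using (Pred)
open import Relation.Binary.Lattice using (JoinSemilattice)

module SL {c ℓ₁ ℓ₂ : Level} (L : JoinSemilattice c ℓ₁ ℓ₂) where
  open JoinSemilattice L

  -- subsets of L (as predicates; all notions below respect ≈)
  Subset : Set _
  Subset = Pred Carrier (c ⊔ ℓ₁ ⊔ ℓ₂)

  -- finite subsets are given by lists; membership is up to ≈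
  _∈ₗ_ : Carrier → List Carrier → Set (c ⊔ ℓ₁)
  x ∈ₗ xs = Any (x ≈_) xs

  ⟦_⟧ : List Carrier → Subset
  ⟦ xs ⟧ x = Level.Lift (c ⊔ ℓ₁ ⊔ ℓ₂) (x ∈ₗ xs)

  ↓ : Subset → Subset
  ↓ M x = ∃[ m ] (M m × x ≤ m)

  ↑ : Subset → Subset
  ↑ M x = ∃[ m ] (M m × m ≤ x)

  Connected : Carrier → Set _
  Connected a = ∀ b d → a ≤ b ∨ d → (a ≤ b) ⊎ (a ≤ d)

  ⋁⁺ : Carrier → List Carrier → Carrier
  ⋁⁺ x [] = x
  ⋁⁺ x (y ∷ ys) = x ∨ ⋁⁺ y ys

  -- every a is the join of a finite set of connected elements
  -- (nonempty: an empty join only exists as a bottom element, which is itself connected)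
  FiniteConnectedDecompositions : Set _
  FiniteConnectedDecompositions =
    ∀ a → ∃[ x ] ∃[ xs ] (Connected x × All Connected xs × a ≈ ⋁⁺ x xs)

  Component : Carrier → Carrier → Set _
  Component a d = Connected d × ((a ≈ d) ⊎ (∃[ b ] (a ≈ b ∨ d × ¬ (b ∨ d ≈ b))))

  Cn-of : Subset → Subset
  Cn-of A x = ∃[ a ] (A a × Component a x)

  Antichain : Subset → Set _
  Antichain M = ∀ x y → M x → M y → x ≤ y → x ≈ y

  FiniteDuality : List Carrier → List Carrier → Set _
  FiniteDuality A B =
    Antichain ⟦ A ⟧ × Antichain ⟦ B ⟧ ×
    (∀ x → (↓ ⟦ B ⟧ x → ¬ ↑ ⟦ A ⟧ x) × (¬ ↑ ⟦ A ⟧ x → ↓ ⟦ B ⟧ x))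

  _⊑_ : Subset → Subset → Set _
  M ⊑ N = ∀ x → N x → ↑ M x

  _≐_ : Subset → Subset → Set _
  M ≐ N = (∀ x → M x → ∃[ y ] (N y × x ≈ y)) × (∀ x → N x → ∃[ y ] (M y × x ≈ y))

  Quasitransversal : Subset → Subset → Set _
  Quasitransversal A M =
    Antichain M × (∀ x → M x → Cn-of A x) × (∀ a → A a → ↑ M a)

  Transversal : Subset → Subset → Set _
  Transversal A N =
    Quasitransversal A N × (∀ N' → Quasitransversal A N' → N ⊑ N' → N' ≐ N)

  -- N̄ = A_Cn ∖ ↑N
  co : Subset → Subset → Subset
  co A N x = Cn-of A x × ¬ ↑ N x

  IsR : Subset → Subset → Carrier → Set _
  IsR A N r = (∀ x → N x → ¬ x ≤ r) × (∀ x → co A N x → x ≤ r)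

  MinOutside : Subset → Carrier → Subset
  MinOutside A r x =
    (Cn-of A x × ¬ x ≤ r) × (∀ y → Cn-of A y → ¬ y ≤ r → y ≤ x → y ≈ x)

-- Each a ∈ A lies outside ↓B ∋ r, so some piece of a connected decomposition of a is a
-- component of a outside ↓r. Below it sits a minimal such element of A_Cn: two components of
-- one element are incomparable, so passing to a strictly smaller element of A_Cn loses an
-- element of A having a component below it, and A is finite. Hence M covers A.
-- Any quasitransversal N above M avoids ↓r. If N avoids both ↓r and ↓s, then r ∨ s lies above no
-- a ∈ A (the connected element of N below a would lie below r or below s), so by duality
-- r ∨ s ∈ ↓B, and as B is an antichain s ≤ r. With s ∈ N̄ this gives N̄ ⊆ ↓r; with s = r'
-- it gives r' ≤ r, hence r' ≈ r.
module Submission where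

open import Defs
open import Level using (Level; lift; lower)
open import Data.Product using (_×_; ∃-syntax; _,_; proj₁; proj₂)
open import Data.Sum using (_⊎_; inj₁; inj₂)
open import Data.List using (List; []; _∷_; length; filter)
open import Data.List.Properties using (filter-notAll)
open import Data.List.Relation.Unary.All using (All; []; _∷_)
import Data.List.Relation.Unary.Any as Any
open import Data.List.Membership.Setoid.Properties using (∈-filter⁺)
open import Data.Empty using (⊥-elim)
open import Data.Nat using (_<_)
open import Data.Nat.Induction using (<-wellFounded)
open import Induction.WellFounded using (Acc; acc)
open import Relation.Nullary using (¬_; yes; no)
open import Relation.Binary.Bundles using (Poset)
open import Relation.Binary.Lattice using (JoinSemilattice)
open import Axiom.ExcludedMiddle using (ExcludedMiddle)
import Relation.Binary.Lattice.Properties.JoinSemilattice as JoinSemilatticeProperties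

module Components {c ℓ₁ ℓ₂ : Level} (L : JoinSemilattice c ℓ₁ ℓ₂) where
  open JoinSemilattice L
  open JoinSemilatticeProperties L using (∨-comm; ∨-assoc; ∨-cong)
  open SL L

  component-≤ : ∀ {a d} → Component a d → d ≤ a
  component-≤ (_ , inj₁ a≈d) = reflexive (Eq.sym a≈d)
  component-≤ (_ , inj₂ (b , a≈b∨d , _)) = trans (y≤x∨y b _) (reflexive (Eq.sym a≈b∨d))

  component-resp-≈ : ∀ {a a' d} → a ≈ a' → Component a d → Component a' d
  component-resp-≈ a≈a' (cd , inj₁ a≈d) = cd , inj₁ (Eq.trans (Eq.sym a≈a') a≈d)
  component-resp-≈ a≈a' (cd , inj₂ (b , a≈b∨d , ≉)) =
    cd , inj₂ (b , Eq.trans (Eq.sym a≈a') a≈b∨d , ≉)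

  minOutside-antichain : ∀ A r → Antichain (MinOutside A r)
  minOutside-antichain A r x y M-x M-y x≤y = proj₂ M-y x (proj₁ (proj₁ M-x)) (proj₂ (proj₁ M-x)) x≤y

  -- If d ≤ b then e ≤ b, and b ∨ e would collapse to b.
  components-incomparable : ∀ {a d e} → Component a d → Component a e → e ≤ d → d ≤ e
  components-incomparable cd (_ , inj₁ a≈e) _ = trans (component-≤ cd) (reflexive a≈e)
  components-incomparable (conn-d , cd) (_ , inj₂ (b , a≈b∨e , b∨e≉b)) e≤d
    with conn-d b _ (trans (component-≤ (conn-d , cd)) (reflexive a≈b∨e))
  ... | inj₁ d≤b = ⊥-elim (b∨e≉b (antisym (∨-least refl (trans e≤d d≤b)) (x≤x∨y b _)))
  ... | inj₂ d≤e = d≤e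

  module Outside (lem : ∀ {p} → ExcludedMiddle p) (r : Carrier) where

    peel : ∀ {a b x} → Connected x → a ≈ b ∨ x → Component a x ⊎ a ≈ b
    peel {b = b} {x} conn-x a≈b∨x with lem {P = b ∨ x ≈ b}
    ... | yes b∨x≈b = inj₂ (Eq.trans a≈b∨x b∨x≈b)
    ... | no b∨x≉b = inj₁ (conn-x , inj₂ (b , a≈b∨x , b∨x≉b))

    OutsideComponent : Carrier → Set _
    OutsideComponent a = ∃[ d ] (Component a d × ¬ d ≤ r)

    -- p collects the pieces already found to lie below r.
    outside-component-beyond : ∀ {a p} x xs → p ≤ r → Connected x → All Connected xs →
                               a ≈ p ∨ ⋁⁺ x xs → ¬ a ≤ r → OutsideComponent a
    outside-component-beyond x [] p≤r conn-x [] a≈p∨x a≰r with peel conn-x a≈p∨x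
    ... | inj₂ a≈p = ⊥-elim (a≰r (trans (reflexive a≈p) p≤r))
    ... | inj₁ comp = x , comp , λ x≤r → a≰r (trans (reflexive a≈p∨x) (∨-least p≤r x≤r))
    outside-component-beyond {a} {p} x (y ∷ ys) p≤r conn-x (conn-y ∷ conn-ys) a≈ a≰r
      with peel conn-x a≈[p∨t]∨x
      where
        a≈[p∨t]∨x : a ≈ (p ∨ ⋁⁺ y ys) ∨ x
        a≈[p∨t]∨x = Eq.trans a≈ (Eq.trans (∨-cong Eq.refl (∨-comm x _)) (Eq.sym (∨-assoc p _ x)))
    ... | inj₂ a≈p∨t = outside-component-beyond y ys p≤r conn-y conn-ys a≈p∨t a≰r
    ... | inj₁ comp with lem {P = x ≤ r}
    ...   | no x≰r = x , comp , x≰r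
    ...   | yes x≤r = outside-component-beyond y ys (∨-least p≤r x≤r) conn-y conn-ys
                        (Eq.trans a≈ (Eq.sym (∨-assoc p x _))) a≰r

    outside-component : ∀ {a} x xs → Connected x → All Connected xs →
                        a ≈ ⋁⁺ x xs → ¬ a ≤ r → OutsideComponent a
    outside-component x [] conn-x [] a≈x a≰r =
      x , (conn-x , inj₁ a≈x) , λ x≤r → a≰r (trans (reflexive a≈x) x≤r)
    outside-component x (y ∷ ys) conn-x (conn-y ∷ conn-ys) a≈ a≰r
      with peel conn-x (Eq.trans a≈ (∨-comm x _))
    ... | inj₂ a≈t = outside-component y ys conn-y conn-ys a≈t a≰r
    ... | inj₁ comp with lem {P = x ≤ r}
    ...   | no x≰r = x , comp , x≰r
    ...   | yes x≤r = outside-component-beyond y ys x≤r conn-y conn-ys a≈ a≰r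

    module Minimal (A : List Carrier) where

      OutsideCn : Carrier → Set _
      OutsideCn x = Cn-of ⟦ A ⟧ x × ¬ x ≤ r

      HasComponentBelow : Carrier → Carrier → Set _
      HasComponentBelow x a = ∃[ z ] (Component a z × z ≤ x)

      hasComponentBelow-resp : ∀ {x a a'} → a ≈ a' → HasComponentBelow x a → HasComponentBelow x a'
      hasComponentBelow-resp a≈a' (z , cz , z≤x) = z , component-resp-≈ a≈a' cz , z≤x

      -- Xs over-approximates the elements of A having a component below x; its length decreases.
      minimal-below′ : ∀ Xs → Acc _<_ (length Xs) → ∀ x → OutsideCn x →
                       (∀ a → ⟦ A ⟧ a → HasComponentBelow x a → a ∈ₗ Xs) →
                       ∃[ m ] (MinOutside ⟦ A ⟧ r m × m ≤ x)
      minimal-below′ Xs (acc smaller) x out@((a , A-a , comp-x) , _) covers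
        with lem {P = ∃[ y ] (OutsideCn y × y ≤ x × ¬ x ≤ y)}
      ... | no none-smaller = x , (out , minimal) , refl
        where
          minimal : ∀ y → Cn-of ⟦ A ⟧ y → ¬ y ≤ r → y ≤ x → y ≈ x
          minimal y cn-y y≰r y≤x with lem {P = x ≤ y}
          ... | yes x≤y = antisym y≤x x≤y
          ... | no x≰y = ⊥-elim (none-smaller (y , (cn-y , y≰r) , y≤x , x≰y))
      ... | yes (y , out-y , y≤x , x≰y) =
        extend (minimal-below′ Ys (smaller shorter) y out-y covers′)
        where
          extend : ∃[ m ] (MinOutside ⟦ A ⟧ r m × m ≤ y) → ∃[ m ] (MinOutside ⟦ A ⟧ r m × m ≤ x)
          extend (m , min-m , m≤y) = m , min-m , trans m≤y y≤x

          below-y? = λ e → lem {P = HasComponentBelow y e}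
          Ys = filter below-y? Xs

          a-lost : ¬ HasComponentBelow y a
          a-lost (z , comp-z , z≤y) = x≰y (trans (components-incomparable comp-x comp-z (trans z≤y y≤x)) z≤y)

          shorter : length Ys < length Xs
          shorter = filter-notAll below-y? Xs
            (Any.map (λ a≈e below → a-lost (hasComponentBelow-resp (Eq.sym a≈e) below))
                     (covers a A-a (x , comp-x , refl)))

          covers′ : ∀ e → ⟦ A ⟧ e → HasComponentBelow y e → e ∈ₗ Ys
          covers′ e A-e below@(z , comp-z , z≤y) =
            ∈-filter⁺ (Poset.Eq.setoid poset) below-y? hasComponentBelow-resp
              (covers e A-e (z , comp-z , trans z≤y y≤x)) below

      minimal-below : ∀ x → OutsideCn x → ∃[ m ] (MinOutside ⟦ A ⟧ r m × m ≤ x)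
      minimal-below x out = minimal-below′ A (<-wellFounded (length A)) x out (λ a A-a _ → lower A-a)

      minOutside-quasitransversal : FiniteConnectedDecompositions → (∀ a → ⟦ A ⟧ a → ¬ a ≤ r) →
                                    Quasitransversal ⟦ A ⟧ (MinOutside ⟦ A ⟧ r)
      minOutside-quasitransversal decompositions A-outside =
        minOutside-antichain ⟦ A ⟧ r , (λ x M-x → proj₁ (proj₁ M-x)) , covers
        where
          covers : ∀ a → ⟦ A ⟧ a → ↑ (MinOutside ⟦ A ⟧ r) a
          covers a A-a
            with x , xs , conn-x , conn-xs , a≈ ← decompositions a
            with d , comp-d , d≰r ← outside-component x xs conn-x conn-xs a≈ (A-outside a A-a)
            with m , M-m , m≤d ← minimal-below d ((a , A-a , comp-d) , d≰r)
            = m , M-m , trans m≤d (component-≤ comp-d)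

module Transversals {c ℓ₁ ℓ₂ : Level} (L : JoinSemilattice c ℓ₁ ℓ₂) where
  open JoinSemilattice L
  open SL L

  quasitransversal-connected : ∀ {A N} → Quasitransversal A N → ∀ n → N n → Connected n
  quasitransversal-connected (_ , N⊆Cn , _) n N-n with _ , _ , conn-n , _ ← N⊆Cn n N-n = conn-n

  join-of-avoided-not-above : ∀ {A N s t} → Quasitransversal A N →
                              (∀ n → N n → ¬ n ≤ s) → (∀ n → N n → ¬ n ≤ t) → ¬ ↑ A (s ∨ t)
  join-of-avoided-not-above {s = s} {t} qt@(_ , _ , covers) avoid-s avoid-t (a , A-a , a≤s∨t)
    with n , N-n , n≤a ← covers a A-a
    with quasitransversal-connected qt n N-n s t (trans n≤a a≤s∨t)
  ... | inj₁ n≤s = avoid-s n N-n n≤s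
  ... | inj₂ n≤t = avoid-t n N-n n≤t

  above-MinOutside-avoids : ∀ {A r N} → MinOutside A r ⊑ N → ∀ n → N n → ¬ n ≤ r
  above-MinOutside-avoids M⊑N n N-n n≤r with m , M-m , m≤n ← M⊑N n N-n =
    proj₂ (proj₁ M-m) (trans m≤n n≤r)

module Duality {c ℓ₁ ℓ₂ : Level} (L : JoinSemilattice c ℓ₁ ℓ₂)
               (A B : List (JoinSemilattice.Carrier L)) (duality : SL.FiniteDuality L A B) where
  open JoinSemilattice L
  open SL L

  B-antichain : Antichain ⟦ B ⟧
  B-antichain = proj₁ (proj₂ duality)

  A-not-below-B : ∀ {a r} → r ∈ₗ B → ⟦ A ⟧ a → ¬ a ≤ r
  A-not-below-B {a} {r} r∈B A-a a≤r = proj₁ (proj₂ (proj₂ duality) a) (r , lift r∈B , a≤r) (a , A-a , refl)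

  absorbed-by-B : ∀ {r s} → r ∈ₗ B → ¬ ↑ ⟦ A ⟧ (r ∨ s) → s ≤ r
  absorbed-by-B {r} {s} r∈B not-above-A with proj₂ (proj₂ (proj₂ duality) (r ∨ s)) not-above-A
  ... | b , B-b , r∨s≤b =
    trans (y≤x∨y r s) (trans r∨s≤b (reflexive (Eq.sym (B-antichain r b (lift r∈B) B-b (trans (x≤x∨y r s) r∨s≤b)))))

  open Transversals L

  r-of-quasitransversal-above : ∀ {r N} → r ∈ₗ B → Quasitransversal ⟦ A ⟧ N → MinOutside ⟦ A ⟧ r ⊑ N →
                                IsR ⟦ A ⟧ N r × (∀ r' → r' ∈ₗ B → IsR ⟦ A ⟧ N r' → r' ≈ r)
  r-of-quasitransversal-above {r} {N} r∈B qt M⊑N = (avoids-r , N̄-below-r) , unique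
    where
      avoids-r : ∀ n → N n → ¬ n ≤ r
      avoids-r = above-MinOutside-avoids M⊑N

      N̄-below-r : ∀ x → co ⟦ A ⟧ N x → x ≤ r
      N̄-below-r x (_ , not-above-N) =
        absorbed-by-B r∈B (join-of-avoided-not-above qt avoids-r λ n N-n n≤x → not-above-N (n , N-n , n≤x))

      unique : ∀ r' → r' ∈ₗ B → IsR ⟦ A ⟧ N r' → r' ≈ r
      unique r' r'∈B (avoids-r' , _) =
        B-antichain r' r (lift r'∈B) (lift r∈B) (absorbed-by-B r∈B (join-of-avoided-not-above qt avoids-r avoids-r'))

open JoinSemilattice using (Carrier; _≈_)
open SL

mainTheorem13 : (lem : ∀ {p} → ExcludedMiddle p) →
    {c ℓ₁ ℓ₂ : Level} (L : JoinSemilattice c ℓ₁ ℓ₂) →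
    FiniteConnectedDecompositions L →
    (A B : List (Carrier L)) → FiniteDuality L A B →
    (r : Carrier L) → _∈ₗ_ L r B →
    Quasitransversal L (⟦_⟧ L A) (MinOutside L (⟦_⟧ L A) r) ×
    ((N : Subset L) → Transversal L (⟦_⟧ L A) N → _⊑_ L (MinOutside L (⟦_⟧ L A) r) N →
    IsR L (⟦_⟧ L A) N r ×
    ((r' : Carrier L) → _∈ₗ_ L r' B → IsR L (⟦_⟧ L A) N r' → _≈_ L r' r))
mainTheorem13 lem L decompositions A B duality r r∈B =
    minOutside-quasitransversal decompositions (λ _ → A-not-below-B r∈B)
  , λ N transversal → r-of-quasitransversal-above r∈B (proj₁ transversal)
  where
    open Components.Outside.Minimal L lem r A
    open Duality L A B duality
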